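{- Let $G$ be a connected graph with girth $g(G)\ge 5$. Then $\mu_{\rm t}(G)=0$ if and only if $\delta(G)\ge 2$.
   Context: All graphs are finite, simple and connected. The girth $g(G)$ is the length of a shortest cycle of $G$; $\delta(G)$ is the minimum degree. For $X\subseteq V(G)$, two vertices $x,y$ are $X$-visible if there is a shortest $x,y$-path $P$ with $V(P)\cap X\subseteq\{x,y\}$; $X$ is a total mutual-visibility set if every pair of vertices of $G$ is $X$-visible. $\mu_{\rm t}(G)$ is the largest cardinality of a total mutual-visibility set of $G$. -}

module Defs where

open import Data.Nat using (ℕ; zero; suc; _≤_; _⊓_)
open import Data.Bool using (Bool; true; false; if_then_else_)
open import Data.Fin using (Fin; zero; suc; inject₁; fromℕ)
open import Data.Fin.Subset using (Subset; _∈_; _∉_; ∣_∣)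
open import Data.List using (List; map; foldr; allFin)
open import Data.Nat.ListAction using (sum)
open import Data.Product using (Σ; ∃; _×_; _,_)
open import Data.Sum using (_⊎_)
open import Relation.Binary.PropositionalEquality using (_≡_; _≢_)
open import Data.Empty using (⊥)
open import Function using (Injective)

record Graph (n : ℕ) : Set where
  field
    adj   : Fin n → Fin n → Bool
    sym   : ∀ u v → adj u v ≡ adj v u
    irrefl : ∀ v → adj v v ≡ false

open Graph public

Adj : ∀ {n} → Graph n → Fin n → Fin n → Set
Adj G u v = adj G u v ≡ true

Walk : ∀ {n} → Graph n → Fin n → Fin n → (k : ℕ) → (Fin (suc k) → Fin n) → Set
Walk G x y k P =
  (P zero ≡ x) × (P (fromℕ k) ≡ y) × (∀ (i : Fin k) → Adj G (P (inject₁ i)) (P (suc i)))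

-- A shortest x,y-path: a walk of length k from x to y such that every x,y-walk
-- has length ≥ k (so k = d(x,y), and such a walk is automatically a path).
ShortestPath : ∀ {n} → Graph n → Fin n → Fin n → (k : ℕ) → (Fin (suc k) → Fin n) → Set
ShortestPath {n} G x y k P =
  Walk G x y k P × (∀ (m : ℕ) (Q : Fin (suc m) → Fin n) → Walk G x y m Q → k ≤ m)

Connected : ∀ {n} → Graph n → Set
Connected {n} G = ∀ (x y : Fin n) → Σ ℕ λ k → Σ (Fin (suc k) → Fin n) λ P → Walk G x y k P

-- A cycle of length k ≥ 3: distinct vertices C 0, …, C (k-1), cyclically adjacent.
-- (No cycles of length < 3 in a simple graph.) Indexed as k = suc (suc (suc j)) with C (fromℕ _) adjacent to C 0.
Cycle : ∀ {n} → Graph n → (k : ℕ) → (Fin k → Fin n) → Set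
Cycle G zero C = ⊥
Cycle G (suc zero) C = ⊥
Cycle G (suc (suc zero)) C = ⊥
Cycle G (suc (suc (suc j))) C =
  Injective _≡_ _≡_ C
  × (∀ (i : Fin (suc (suc j))) → Adj G (C (inject₁ i)) (C (suc i)))
  × Adj G (C (fromℕ (suc (suc j)))) (C zero)

-- g(G) ≥ g : every cycle has length ≥ g (acyclic graphs have girth ∞).
GirthAtLeast : ∀ {n} → Graph n → ℕ → Set
GirthAtLeast {n} G g = ∀ (k : ℕ) (C : Fin k → Fin n) → Cycle G k C → g ≤ k

degree : ∀ {n} → Graph n → Fin n → ℕ
degree {n} G v = sum (map (λ u → if adj G v u then 1 else 0) (allFin n))

minDegree : ∀ {n} → Graph (suc n) → ℕ
minDegree {n} G = foldr _⊓_ (degree G zero) (map (degree G) (allFin (suc n)))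

Visible : ∀ {n} → Graph n → Subset n → Fin n → Fin n → Set
Visible {n} G X x y =
  Σ ℕ λ k → Σ (Fin (suc k) → Fin n) λ P →
    ShortestPath G x y k P × (∀ (i : Fin (suc k)) → P i ∈ X → (P i ≡ x ⊎ P i ≡ y))

TotalMutualVisibility : ∀ {n} → Graph n → Subset n → Set
TotalMutualVisibility {n} G X = ∀ (x y : Fin n) → Visible G X x y

IsMuT : ∀ {n} → Graph n → ℕ → Set
IsMuT {n} G m =
  (Σ (Subset n) λ X → TotalMutualVisibility G X × ∣ X ∣ ≡ m)
  × (∀ (X : Subset n) → TotalMutualVisibility G X → ∣ X ∣ ≤ m)

-- A vertex v of degree at most one is never an inner vertex of a shortest path, since its two
-- path-neighbours would coincide and the path could be shortened; hence ⁅ v ⁆ is a total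
-- mutual-visibility set and μ_t(G) ≥ 1. Conversely, if v has two distinct neighbours a and b,
-- girth ≥ 5 excludes a shortest a,b-path of length 1 (a triangle) or of length 2 avoiding v
-- (a 4-cycle), so every shortest a,b-path passes through v and v lies in no total
-- mutual-visibility set; the empty set always is one.
module Submission where

open import Defs
open import Data.Nat using (ℕ; suc; _≤_)
open import Function.Bundles using (_⇔_)

open import Data.Nat using (zero; _+_; _<_; z≤n; s≤s; _≤?_)
open import Data.Nat.Properties
  using (≤-trans; ≤-reflexive; ≤-pred; ≰⇒>; ≮⇒≥; <⇒≱; m≤n+m; +-suc; +-identityʳ;
         m<1+n⇒m<n∨m≡n; m≤n⇒m⊓o≤n; m≤n⇒o⊓m≤n; ⊓-sel)
open import Data.Bool using (Bool; true; false; if_then_else_)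
import Data.Bool.Properties as Bool
open import Data.Fin using (Fin; zero; suc; inject₁)
import Data.Fin.Properties as Fin
open import Data.Fin.Subset using (_∈_; _∉_; ∣_∣; ⊥; ⁅_⁆)
open import Data.Fin.Subset.Properties using (∉⊥; ∣⊥∣≡0; ∣⁅x⁆∣≡1; x∈⁅y⁆⇒x≡y; Empty-unique)
open import Data.List using (map; allFin)
open import Data.List.Properties using (map-tabulate; foldr-preservesᵒ)
open import Data.List.Relation.Unary.Any as Any using ()
open import Data.List.Membership.Propositional.Properties using (∈-allFin; ∈-map⁺; ∈-map⁻; foldr-selective)
open import Data.Nat.ListAction using (sum)
open import Data.Vec.Functional using (Vector; []; _∷_; tail)
open import Data.Product using (∃; ∃₂; _×_; _,_; proj₁)
open import Data.Sum using (_⊎_; inj₁; inj₂; [_,_]; [_,_]′)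
open import Data.Empty using (⊥-elim)
open import Relation.Nullary using (¬_; Dec; yes; no; contradiction)
open import Relation.Nullary.Decidable using (_×-dec_; map′)
open import Relation.Unary using (Decidable)
open import Relation.Binary.PropositionalEquality as ≡ using (_≡_; _≢_; refl; trans; cong; subst; subst₂)
open import Function using (_∘_; mk⇔; Injective)

least-witness : {P : ℕ → Set} → Decidable P → ∀ {k} → P k →
                ∃ λ m → P m × (∀ {j} → P j → m ≤ j)
least-witness {P} P? {k} p = search 0 k (λ ()) (subst P (≡.sym (+-identityʳ k)) p)
  where
  search : ∀ b k → (∀ {j} → j < b → ¬ P j) → P (k + b) → ∃ λ m → P m × (∀ {j} → P j → m ≤ j)
  search b k below p with P? b
  ... | yes pb = b , pb , λ pj → ≮⇒≥ (λ j<b → below j<b pj)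
  search b zero    below p | no ¬pb = contradiction p ¬pb
  search b (suc k) below p | no ¬pb = search (suc b) k below′ (subst P (≡.sym (+-suc k b)) p)
    where
    below′ : ∀ {j} → j < suc b → ¬ P j
    below′ j<1+b with m<1+n⇒m<n∨m≡n j<1+b
    ... | inj₁ j<b = below j<b
    ... | inj₂ refl = ¬pb

∷-injective : ∀ {a} {A : Set a} {k} {x : A} {C : Vector A k} →
              Injective _≡_ _≡_ C → (∀ i → x ≢ C i) → Injective _≡_ _≡_ (x ∷ C)
∷-injective inj fresh {zero}  {zero}  _ = refl
∷-injective inj fresh {zero}  {suc j} e = ⊥-elim (fresh j e)
∷-injective inj fresh {suc i} {zero}  e = ⊥-elim (fresh i (≡.sym e))
∷-injective inj fresh {suc i} {suc j} e = cong suc (inj e)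

[]-injective : ∀ {a} {A : Set a} → Injective _≡_ _≡_ ([] {A = A})
[]-injective {x = ()}

count : ∀ {n} → (Fin n → Bool) → ℕ
count {n} f = sum (map (λ u → if f u then 1 else 0) (allFin n))

count-suc : ∀ {n} (f : Fin (suc n) → Bool) → count f ≡ (if f zero then 1 else 0) + count (tail f)
count-suc {n} f = cong (λ xs → (if f zero then 1 else 0) + sum xs)
  (trans (map-tabulate suc indicator) (≡.sym (map-tabulate (λ u → u) (indicator ∘ suc))))
  where
  indicator : Fin (suc n) → ℕ
  indicator u = if f u then 1 else 0

count-positive : ∀ {n} (f : Fin n → Bool) {a} → f a ≡ true → 1 ≤ count f
count-positive {suc n} f {zero} fa rewrite count-suc f | fa = s≤s z≤n
count-positive {suc n} f {suc a} fa rewrite count-suc f =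
  ≤-trans (count-positive (tail f) fa) (m≤n+m _ _)

count-≥2 : ∀ {n} (f : Fin n → Bool) {a b} → a ≢ b → f a ≡ true → f b ≡ true → 2 ≤ count f
count-≥2 {suc n} f {zero}  {zero}  a≢b _  _  = contradiction refl a≢b
count-≥2 {suc n} f {zero}  {suc b} a≢b fa fb rewrite count-suc f | fa = s≤s (count-positive (tail f) fb)
count-≥2 {suc n} f {suc a} {zero}  a≢b fa fb rewrite count-suc f | fb = s≤s (count-positive (tail f) fa)
count-≥2 {suc n} f {suc a} {suc b} a≢b fa fb rewrite count-suc f =
  ≤-trans (count-≥2 (tail f) (a≢b ∘ cong suc) fa fb) (m≤n+m _ _)

count-positive⁻ : ∀ {n} (f : Fin n → Bool) → 1 ≤ count f → ∃ λ a → f a ≡ true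
count-positive⁻ {suc n} f p rewrite count-suc f with f zero in fa
... | true  = zero , fa
... | false = let a , fsa = count-positive⁻ (tail f) p in suc a , fsa

count-≥2⁻ : ∀ {n} (f : Fin n → Bool) → 2 ≤ count f →
            ∃₂ λ a b → a ≢ b × f a ≡ true × f b ≡ true
count-≥2⁻ {suc n} f p rewrite count-suc f with f zero in fa
... | true  = let b , fsb = count-positive⁻ (tail f) (≤-pred p) in zero , suc b , (λ ()) , fa , fsb
... | false = let a , b , a≢b , fsa , fsb = count-≥2⁻ (tail f) p
              in suc a , suc b , a≢b ∘ Fin.suc-injective , fsa , fsb

minDegree≤degree : ∀ {n} (G : Graph (suc n)) v → minDegree G ≤ degree G v
minDegree≤degree {n} G v =
  foldr-preservesᵒ (λ x y → [ m≤n⇒m⊓o≤n y , m≤n⇒o⊓m≤n x ])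
    (degree G zero) (map (degree G) (allFin (suc n)))
    (inj₂ (Any.map (≤-reflexive ∘ ≡.sym) (∈-map⁺ (degree G) (∈-allFin v))))

minDegree-attained : ∀ {n} (G : Graph (suc n)) → ∃ λ v → minDegree G ≡ degree G v
minDegree-attained {n} G with foldr-selective ⊓-sel (degree G zero) (map (degree G) (allFin (suc n)))
... | inj₁ δ≡deg₀ = zero , δ≡deg₀
... | inj₂ δ∈degrees = let v , _ , δ≡deg = ∈-map⁻ (degree G) δ∈degrees in v , δ≡deg

module _ {n : ℕ} (G : Graph n) where

  adj⇒≢ : ∀ {u v} → Adj G u v → u ≢ v
  adj⇒≢ {u} uv refl with () ← trans (≡.sym (irrefl G u)) uv

  adj-sym : ∀ {u v} → Adj G u v → Adj G v u
  adj-sym {u} {v} uv = trans (Graph.sym G v u) uv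

  adj? : ∀ u v → Dec (Adj G u v)
  adj? u v = adj G u v Bool.≟ true

  neighbours-unique : ∀ {v a b} → degree G v ≤ 1 → Adj G v a → Adj G v b → a ≡ b
  neighbours-unique {v} {a} {b} deg va vb with a Fin.≟ b
  ... | yes a≡b = a≡b
  ... | no  a≢b = contradiction (≤-trans (count-≥2 (adj G v) a≢b va vb) deg) λ { (s≤s ()) }

  two-neighbours : ∀ {v} → 2 ≤ degree G v → ∃₂ λ a b → a ≢ b × Adj G v a × Adj G v b
  two-neighbours {v} = count-≥2⁻ (adj G v)

  triangle⇒girth≤3 : ∀ {g a b c} → Adj G a b → Adj G b c → Adj G c a → GirthAtLeast G g → g ≤ 3
  triangle⇒girth≤3 {a = a} {b} {c} ab bc ca girth = girth 3 (a ∷ b ∷ c ∷ []) (injective , edges , ca)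
    where
    injective : Injective _≡_ _≡_ (a ∷ b ∷ c ∷ [])
    injective =
      ∷-injective (∷-injective (∷-injective []-injective λ ()) λ { zero → adj⇒≢ bc })
        λ { zero → adj⇒≢ ab ; (suc zero) → adj⇒≢ ca ∘ ≡.sym }
    edges : ∀ i → Adj G ((a ∷ b ∷ c ∷ []) (inject₁ i)) ((a ∷ b ∷ c ∷ []) (suc i))
    edges zero = ab
    edges (suc zero) = bc

  square⇒girth≤4 : ∀ {g a b c d} → Adj G a b → Adj G b c → Adj G c d → Adj G d a →
                   a ≢ c → b ≢ d → GirthAtLeast G g → g ≤ 4
  square⇒girth≤4 {a = a} {b} {c} {d} ab bc cd da a≢c b≢d girth =
    girth 4 (a ∷ b ∷ c ∷ d ∷ []) (injective , edges , da)
    where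
    injective : Injective _≡_ _≡_ (a ∷ b ∷ c ∷ d ∷ [])
    injective =
      ∷-injective
        (∷-injective (∷-injective (∷-injective []-injective λ ()) λ { zero → adj⇒≢ cd })
          λ { zero → adj⇒≢ bc ; (suc zero) → b≢d })
        λ { zero → adj⇒≢ ab ; (suc zero) → a≢c ; (suc (suc zero)) → adj⇒≢ da ∘ ≡.sym }
    edges : ∀ i → Adj G ((a ∷ b ∷ c ∷ d ∷ []) (inject₁ i)) ((a ∷ b ∷ c ∷ d ∷ []) (suc i))
    edges zero = ab
    edges (suc zero) = bc
    edges (suc (suc zero)) = cd

  walk-first-edge : ∀ {x y k P} → Walk G x y (suc k) P → Adj G x (P (suc zero))
  walk-first-edge (refl , _ , edges) = edges zero

  walk-tail : ∀ {x y k P} → Walk G x y (suc k) P → Walk G (P (suc zero)) y k (tail P)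
  walk-tail (_ , end , edges) = refl , end , edges ∘ suc

  walk-cons : ∀ {x u y k P} → Adj G x u → Walk G u y k P → Walk G x y (suc k) (x ∷ P)
  walk-cons xu (refl , end , edges) = refl , end , λ { zero → xu ; (suc i) → edges i }

  walk? : ∀ x y k → Dec (∃ (Walk G x y k))
  walk? x y zero = map′ (λ { refl → (λ _ → x) , refl , refl , λ () })
                        (λ { (P , start , end , _) → trans (≡.sym start) end })
                        (x Fin.≟ y)
  walk? x y (suc k) = map′ (λ { (u , xu , P , w) → x ∷ P , walk-cons xu w })
                           (λ { (P , w) → P (suc zero) , walk-first-edge {P = P} w ,
                                          tail P , walk-tail {P = P} w })
                           (Fin.any? λ u → adj? x u ×-dec walk? u y k)

  shortestPath : Connected G → ∀ x y → ∃₂ λ k P → ShortestPath G x y k P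
  shortestPath connected x y =
    let k , walk = connected x y
        m , (P , w) , minimal = least-witness (walk? x y) walk
    in m , P , w , λ _ Q q → minimal (Q , q)

  shortestPath-tail : ∀ {x y k P} → ShortestPath G x y (suc k) P →
                      ShortestPath G (P (suc zero)) y k (tail P)
  shortestPath-tail {x} {P = P} (w , minimal) =
    walk-tail {P = P} w ,
    λ m Q q → ≤-pred (minimal (suc m) (x ∷ Q) (walk-cons {P = Q} (walk-first-edge {P = P} w) q))

  shortestPath-no-backtrack : ∀ {x y k P} → ShortestPath G x y (suc (suc k)) P →
                              P zero ≢ P (suc (suc zero))
  shortestPath-no-backtrack {k = k} {P} sp@((refl , _) , minimal) P₀≡P₂ =
    <⇒≱ (s≤s (m≤n+m k 1)) (minimal k (tail (tail P)) shortcut)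
    where
    shortcut : Walk G (P zero) _ k (tail (tail P))
    shortcut = subst (λ z → Walk G z _ k (tail (tail P))) (≡.sym P₀≡P₂)
                     (proj₁ (shortestPath-tail {P = tail P} (shortestPath-tail {P = P} sp)))

  leaf-on-shortestPath-is-end : ∀ {v x y k P} → degree G v ≤ 1 → ShortestPath G x y k P →
                                ∀ i → P i ≡ v → P i ≡ x ⊎ P i ≡ y
  leaf-on-shortestPath-is-end deg ((start , _) , _) zero _ = inj₁ start
  leaf-on-shortestPath-is-end {k = 1} deg ((_ , end , _) , _) (suc zero) _ = inj₂ end
  leaf-on-shortestPath-is-end {v} {k = suc (suc k)} {P} deg sp@((_ , _ , edges) , _) (suc j) P[1+j]≡v
    with leaf-on-shortestPath-is-end deg (shortestPath-tail {P = P} sp) j P[1+j]≡v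
  ... | inj₂ P[1+j]≡y  = inj₂ P[1+j]≡y
  ... | inj₁ P[1+j]≡P₁ =
    contradiction (neighbours-unique deg (at-v (adj-sym (edges zero))) (at-v (edges (suc zero))))
                  (shortestPath-no-backtrack {P = P} sp)
    where
    at-v : ∀ {u} → Adj G (P (suc zero)) u → Adj G v u
    at-v = subst (λ z → Adj G z _) (trans (≡.sym P[1+j]≡P₁) P[1+j]≡v)

  ⊥-isTotalMutualVisibility : Connected G → TotalMutualVisibility G ⊥
  ⊥-isTotalMutualVisibility connected x y =
    let k , P , sp = shortestPath connected x y in k , P , sp , λ _ P∈⊥ → contradiction P∈⊥ ∉⊥

  ⁅leaf⁆-isTotalMutualVisibility : ∀ {v} → Connected G → degree G v ≤ 1 → TotalMutualVisibility G ⁅ v ⁆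
  ⁅leaf⁆-isTotalMutualVisibility connected deg x y =
    let k , P , sp = shortestPath connected x y
    in k , P , sp , λ i Pi∈⁅v⁆ → leaf-on-shortestPath-is-end deg sp i (x∈⁅y⁆⇒x≡y _ Pi∈⁅v⁆)

  module _ (girth : GirthAtLeast G 5) where

    shortestPath-through-common-neighbour : ∀ {v a b k P} → Adj G v a → Adj G v b → a ≢ b →
                                            ShortestPath G a b k P → ∃ λ i → P i ≡ v
    shortestPath-through-common-neighbour {k = 0} _ _ a≢b ((start , end , _) , _) =
      contradiction (trans (≡.sym start) end) a≢b
    shortestPath-through-common-neighbour {k = 1} va vb _ ((start , end , edges) , _) =
      contradiction (triangle⇒girth≤3 (subst₂ (Adj G) start end (edges zero)) (adj-sym vb) va girth)
                    λ { (s≤s (s≤s (s≤s ()))) }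
    shortestPath-through-common-neighbour {v} {a} {b} {k = 2} {P} va vb a≢b ((start , end , edges) , _)
      with P (suc zero) Fin.≟ v
    ... | yes P₁≡v = suc zero , P₁≡v
    ... | no  P₁≢v =
      contradiction (square⇒girth≤4 aP₁ P₁b (adj-sym vb) va a≢b P₁≢v girth)
                    λ { (s≤s (s≤s (s≤s (s≤s ())))) }
      where
      aP₁ : Adj G a (P (suc zero))
      aP₁ = subst (λ z → Adj G z (P (suc zero))) start (edges zero)
      P₁b : Adj G (P (suc zero)) b
      P₁b = subst (Adj G (P (suc zero))) end (edges (suc zero))
    shortestPath-through-common-neighbour {v} {a} {b} {k = suc (suc (suc _))} va vb _ (_ , minimal) =
      contradiction (minimal 2 (a ∷ v ∷ b ∷ []) (refl , refl , λ { zero → adj-sym va ; (suc zero) → vb }))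
                    λ { (s≤s (s≤s ())) }

    degree≥2⇒∉totalMutualVisibility : ∀ {X v} → 2 ≤ degree G v → TotalMutualVisibility G X → v ∉ X
    degree≥2⇒∉totalMutualVisibility {X} {v} deg tmv v∈X =
      let a , b , a≢b , va , vb = two-neighbours deg
          k , P , sp , inner = tmv a b
          i , Pi≡v = shortestPath-through-common-neighbour {P = P} va vb a≢b sp
      in [ adj⇒≢ va ∘ trans (≡.sym Pi≡v) , adj⇒≢ vb ∘ trans (≡.sym Pi≡v) ]′
           (inner i (subst (_∈ X) (≡.sym Pi≡v) v∈X))

minDegree≥2⇒totalMutualVisibility≡⊥ : ∀ {n} (G : Graph (suc n)) → GirthAtLeast G 5 → 2 ≤ minDegree G →
                           ∀ {X} → TotalMutualVisibility G X → X ≡ ⊥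
minDegree≥2⇒totalMutualVisibility≡⊥ G girth δ≥2 tmv =
  Empty-unique λ (v , v∈X) →
    degree≥2⇒∉totalMutualVisibility G girth (≤-trans δ≥2 (minDegree≤degree G v)) tmv v∈X

corollary3p4 : ∀ (n : ℕ) (G : Graph (suc n)) → Connected G → GirthAtLeast G 5 →
    (IsMuT G 0 ⇔ 2 ≤ minDegree G)
corollary3p4 n G connected girth = mk⇔ μt≡0⇒δ≥2 δ≥2⇒μt≡0
  where
  μt≡0⇒δ≥2 : IsMuT G 0 → 2 ≤ minDegree G
  μt≡0⇒δ≥2 (_ , maximal) with 2 ≤? minDegree G
  ... | yes δ≥2 = δ≥2
  ... | no  δ≱2 =
    let v , δ≡deg = minDegree-attained G
        leaf = subst (_≤ 1) δ≡deg (≤-pred (≰⇒> δ≱2))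
        ∣⁅v⁆∣≤0 = maximal ⁅ v ⁆ (⁅leaf⁆-isTotalMutualVisibility G connected leaf)
    in contradiction (subst (_≤ 0) (∣⁅x⁆∣≡1 v) ∣⁅v⁆∣≤0) λ ()
  δ≥2⇒μt≡0 : 2 ≤ minDegree G → IsMuT G 0
  δ≥2⇒μt≡0 δ≥2 =
    (⊥ , ⊥-isTotalMutualVisibility G connected , ∣⊥∣≡0 (suc n)) ,
    λ X tmv → ≤-reflexive (trans (cong ∣_∣ (minDegree≥2⇒totalMutualVisibility≡⊥ G girth δ≥2 tmv))
                                 (∣⊥∣≡0 (suc n)))
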